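{- Let $a\ge0$, $b>0$ and $\alpha\in\{0,1\}^a$, let $\beta=0^a1^b\alpha$ and $n=|\beta|$. For each vertex $y\in[n]$ there is a binary idempotent polymorphism $f_y$ of $\mathcal{P}_\beta$ such that $f_y(1,x)=x$ for all $x\in[n]$ and $f_y(n,1)=y$.
   Context: For $\beta\in\{0,1\}^n$, $\mathcal{P}_\beta$ is the undirected graph on vertices $1,\dots,n$ with edges $\{i,i+1\}$ for $i<n$ and a loop at $i$ iff the $i$-th letter of $\beta$ is $1$. A binary polymorphism is a map $f:[n]^2\to[n]$ such that whenever $\{u,u'\}$ and $\{v,v'\}$ are edges (loops allowed), $\{f(u,v),f(u',v')\}$ is an edge; it is idempotent if $f(x,x)=x$ for all $x$. -}

module Defs where

open import Data.Nat using (ℕ; zero; suc; _+_; _<_; _∸_; s≤s; z≤n)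
open import Data.Nat.Properties using (<-≤-trans; ≤-trans; m≤n+m; m≤m+n; n<1+n)
open import Data.Bool using (Bool; true; false)
open import Data.Fin using (Fin; toℕ; fromℕ<)
open import Data.Vec using (Vec; lookup; replicate; _++_)
open import Data.Product using (_×_)
open import Data.Sum using (_⊎_)
open import Relation.Binary.PropositionalEquality using (_≡_)

-- Vertices of P_β for β ∈ {0,1}^n are Fin n; Fin index i stands for vertex i+1.
-- Bits: 0 = false, 1 = true.

Edge : {n : ℕ} → Vec Bool n → Fin n → Fin n → Set
Edge β u v =
  (toℕ v ≡ suc (toℕ u)) ⊎ (toℕ u ≡ suc (toℕ v)) ⊎ ((u ≡ v) × (lookup β u ≡ true))

IsPolymorphism : {n : ℕ} → Vec Bool n → (Fin n → Fin n → Fin n) → Set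
IsPolymorphism β f =
  ∀ u u' v v' → Edge β u u' → Edge β v v' → Edge β (f u v) (f u' v')

IsIdempotent : {n : ℕ} → (Fin n → Fin n → Fin n) → Set
IsIdempotent f = ∀ x → f x x ≡ x

betaWord : (a b : ℕ) → Vec Bool a → Vec Bool (a + b + a)
betaWord a b α = (replicate a false ++ replicate b true) ++ α

-- n = |β| = a + b + a.  With b = suc b', n > 0.
-- firstIndex = vertex 1 (Fin index 0); lastIndex = vertex n (Fin index n-1).
firstIndex : (a b' : ℕ) → Fin (a + suc b' + a)
firstIndex a b' = fromℕ< {0} (lemma-pos a b')
  where
  lemma-pos : (a b' : ℕ) → 0 < a + suc b' + a
  lemma-pos a b' = <-≤-trans (s≤s z≤n) (≤-trans (m≤n+m (suc b') a) (m≤m+n (a + suc b') a))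

lastIndex : (a b' : ℕ) → Fin (a + suc b' + a)
lastIndex a b' = fromℕ< {a + suc b' + a ∸ 1} (m∸1<m (a + suc b' + a) (firstIndex a b'))
  where
  m∸1<m : (m : ℕ) → Fin m → m ∸ 1 < m
  m∸1<m (suc m) _ = n<1+n m

-- Number the vertices 0, …, last = c + a (c = a + b - 1): no vertex below a has a
-- loop and every vertex of [a, c] has one. A binary operation F is then a polymorphism
-- as soon as it changes by at most one along every edge of the square and takes the
-- same value at both ends only on a looped vertex. We take F u v = v ⊔ H u v with
-- H u v ≤ v on the first row and on the diagonal. Row by row, H follows zigzags (the
-- largest number ≤ k of a prescribed parity), which move by one per step; in the
-- loopless columns an unlooped value of F has the parity of the column (up to a shift
-- fixed per region of rows), so F cannot stall there. For y ≥ a,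
-- H = W ⊓ (a ⊔ (y ∸ v)) with W climbing with the row; for y < a the rows above a
-- descend again, H = ((v + y) ⊓ a) ⊔ zigzag, and reach y on the last row.

module Submission where

open import Defs
open import Data.Nat
  using (ℕ; zero; suc; pred; _+_; _∸_; _≤_; _<_; _⊔_; _⊓_; z≤n; s≤s; _<?_; _≤?_; parity)
open import Data.Nat.Properties
open import Data.Parity using (Parity; 0ℙ; 1ℙ; _⁻¹) renaming (_+_ to _⊕_)
open import Data.Parity.Properties
  using (suc-homo-⁻¹; +-homo-+; p≢p⁻¹; p+p≡0ℙ; ⁻¹-selfInverse; ⁻¹-injective)
  renaming (+-identityʳ to ⊕-identityʳ)
open import Data.Bool using (Bool; true; false)
open import Data.Fin using (Fin; toℕ; fromℕ<; _↑ˡ_; _↑ʳ_)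
open import Data.Fin.Properties using (toℕ-fromℕ<; toℕ-injective; toℕ<n; toℕ-↑ˡ; toℕ-↑ʳ)
open import Data.Vec using (Vec; lookup; replicate; _++_)
open import Data.Vec.Properties using (lookup-++ˡ; lookup-++ʳ; lookup-++-<; lookup-replicate)
open import Data.Product using (Σ; ∃; _×_; _,_; proj₁; proj₂)
open import Data.Sum using (_⊎_; inj₁; inj₂)
open import Data.Empty using (⊥-elim)
open import Relation.Nullary using (¬_; Dec; yes; no)
open import Relation.Binary using (tri<; tri≈; tri>)
open import Relation.Binary.PropositionalEquality

Near : ℕ → ℕ → Set
Near x y = x ≤ suc y × y ≤ suc x

near-refl : ∀ {x} → Near x x
near-refl {x} = n≤1+n x , n≤1+n x

near-sym : ∀ {x y} → Near x y → Near y x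
near-sym (p , q) = q , p

near-suc : ∀ {x} → Near x (suc x)
near-suc {x} = m<n⇒m≤1+n (n<1+n x) , ≤-refl

near-⊔ : ∀ {x x' y y'} → Near x x' → Near y y' → Near (x ⊔ y) (x' ⊔ y')
near-⊔ (p , q) (r , s) = ⊔-mono-≤ p r , ⊔-mono-≤ q s

near-⊓ : ∀ {x x' y y'} → Near x x' → Near y y' → Near (x ⊓ y) (x' ⊓ y')
near-⊓ (p , q) (r , s) = ⊓-mono-≤ p r , ⊓-mono-≤ q s

near-+ : ∀ {x x'} k → Near x x' → Near (x + k) (x' + k)
near-+ k (p , q) = +-monoˡ-≤ k p , +-monoˡ-≤ k q

near-∸ : ∀ m {x x'} → Near x x' → Near (m ∸ x) (m ∸ x')
near-∸ m (p , q) = one-sided q , one-sided p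
  where
  one-sided : ∀ {z z'} → z' ≤ suc z → m ∸ z ≤ suc (m ∸ z')
  one-sided {z} {z'} z'≤ = m≤n+o⇒m∸n≤o m z (begin
    m                  ≤⟨ m≤n+m∸n m z' ⟩
    z' + (m ∸ z')      ≤⟨ +-monoˡ-≤ (m ∸ z') z'≤ ⟩
    suc z + (m ∸ z')   ≡⟨ sym (+-suc z (m ∸ z')) ⟩
    z + suc (m ∸ z')   ∎)
    where open ≤-Reasoning

data Step : ℕ → ℕ → Set where
  up   : ∀ {x} → Step x (suc x)
  down : ∀ {x} → Step (suc x) x

step-sym : ∀ {x y} → Step x y → Step y x
step-sym up   = down
step-sym down = up

step-near : ∀ {x y} → Step x y → Near x y
step-near up   = near-suc
step-near down = near-sym near-suc

step-+ : ∀ {x y} k → Step x y → Step (x + k) (y + k)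
step-+ k up   = up
step-+ k down = down

parity-suc : ∀ n → parity (suc n) ≡ parity n ⁻¹
parity-suc n = sym (⁻¹-selfInverse (suc-homo-⁻¹ n))

step-parity : ∀ {x y} → Step x y → parity x ≢ parity y
step-parity {x} up   eq = p≢p⁻¹ (parity x) (trans eq (parity-suc x))
step-parity {_} {y} down eq = p≢p⁻¹ (parity y) (trans (sym eq) (parity-suc y))

parity-+≡0ℙ : ∀ m n → parity (m + n) ≡ 0ℙ → parity m ≡ parity n
parity-+≡0ℙ m n eq with parity m | parity n | trans (sym (+-homo-+ m n)) eq
... | 0ℙ | 0ℙ | _  = refl
... | 1ℙ | 1ℙ | _  = refl
... | 0ℙ | 1ℙ | ()
... | 1ℙ | 0ℙ | ()

parity-double : ∀ n → parity (n + n) ≡ 0ℙ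
parity-double n = trans (+-homo-+ n n) (p+p≡0ℙ (parity n))

bit : Parity → ℕ
bit 0ℙ = 0
bit 1ℙ = 1

-- For k > 0, zigzag k t is the largest number ≤ k with the parity of t.
zigzag : ℕ → ℕ → ℕ
zigzag k t = k ∸ bit (parity (k + t))

zigzag-≤ : ∀ k t → zigzag k t ≤ k
zigzag-≤ k t = m∸n≤m k (bit (parity (k + t)))

≤-zigzag : ∀ k t → k ≤ suc (zigzag k t)
≤-zigzag k t with parity (k + t)
... | 0ℙ = n≤1+n k
... | 1ℙ = m≤n+m∸n k 1

<⇒≤-zigzag : ∀ {j k t} → j < k → j ≤ zigzag k t
<⇒≤-zigzag {k = k} {t} j<k = ≤-pred (≤-trans j<k (≤-zigzag k t))

near-zigzag : ∀ k t → Near (zigzag k t) k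
near-zigzag k t = m≤n⇒m≤1+n (zigzag-≤ k t) , ≤-zigzag k t

near-zigzag-row : ∀ k t t' → Near (zigzag k t) (zigzag k t')
near-zigzag-row k t t' =
  ≤-trans (zigzag-≤ k t) (≤-zigzag k t') , ≤-trans (zigzag-≤ k t') (≤-zigzag k t)

near-zigzag-suc : ∀ k t → Near k (zigzag (suc k) t)
near-zigzag-suc k t with parity (suc k + t)
... | 0ℙ = near-suc
... | 1ℙ = near-refl

near-∸-bit : ∀ k p → Near (k ∸ bit p) (suc k ∸ bit p)
near-∸-bit k       0ℙ = near-suc
near-∸-bit zero    1ℙ = z≤n , z≤n
near-∸-bit (suc k) 1ℙ = near-suc

-- Both sides subtract the same bit, since k + t and suc k + t' differ by 0 or 2.
zigzag-step : ∀ k {t t'} → Step t t' → Near (zigzag k t) (zigzag (suc k) t')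
zigzag-step k {t} up rewrite +-suc k t = near-∸-bit k (parity (k + t))
zigzag-step k {_} {t'} down rewrite +-suc k t' = near-∸-bit k (parity (suc (k + t')))

zigzag-pred-step : ∀ k {t t'} → Step t t' → Near (zigzag k t) (zigzag (pred k) t')
zigzag-pred-step zero {t} {t'} _
  rewrite 0∸n≡0 (bit (parity t)) | 0∸n≡0 (bit (parity t')) = near-refl
zigzag-pred-step (suc k) s = near-sym (zigzag-step k (step-sym s))

parity-zigzag : ∀ k t → parity (zigzag (suc k) t) ≡ parity t
parity-zigzag k t with parity (suc k + t) in eq
... | 0ℙ = parity-+≡0ℙ (suc k) t eq
... | 1ℙ = parity-+≡0ℙ k t (⁻¹-injective (trans (sym (parity-suc (k + t))) eq))

zigzag-suc-self : ∀ x → zigzag (suc x) x ≡ x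
zigzag-suc-self x rewrite parity-suc (x + x) | parity-double x = refl

zigzag-≤-small : ∀ k t → k ≤ 1 → zigzag k t ≤ t
zigzag-≤-small zero    t       _ rewrite 0∸n≡0 (bit (parity t)) = z≤n
zigzag-≤-small (suc zero) zero _ = z≤n
zigzag-≤-small (suc zero) (suc t) _ = ≤-trans (zigzag-≤ 1 (suc t)) (s≤s z≤n)
zigzag-≤-small (suc (suc k)) t (s≤s ())

≤-zigzag-self : ∀ {k t} → t ≤ k → t ≤ zigzag k t
≤-zigzag-self {k} {t} t≤k with parity (k + t) in eq | m≤n⇒m<n∨m≡n t≤k
... | 0ℙ | _         = t≤k
... | 1ℙ | inj₁ t<k  = <⇒≤pred t<k
... | 1ℙ | inj₂ refl with () ← trans (sym eq) (parity-double t)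

parity-⊔-zigzag : ∀ k t → parity (t ⊔ zigzag k t) ≡ parity t
parity-⊔-zigzag zero    t rewrite 0∸n≡0 (bit (parity t)) | ⊔-identityʳ t = refl
parity-⊔-zigzag (suc k) t with ⊔-sel t (zigzag (suc k) t)
... | inj₁ eq = cong parity eq
... | inj₂ eq = trans (cong parity eq) (parity-zigzag k t)

parity-∸ : ∀ {v y} → v ≤ y → parity (y ∸ v) ≡ parity (v + y)
parity-∸ {v} {y} v≤y = sym (begin
  parity (v + y)              ≡⟨ cong (λ z → parity (v + z)) (sym (m∸n+n≡m v≤y)) ⟩
  parity (v + (d + v))        ≡⟨ cong parity (+-comm v (d + v)) ⟩
  parity (d + v + v)          ≡⟨ cong parity (+-assoc d v v) ⟩
  parity (d + (v + v))        ≡⟨ +-homo-+ d (v + v) ⟩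
  parity d ⊕ parity (v + v)   ≡⟨ cong (parity d ⊕_) (parity-double v) ⟩
  parity d ⊕ 0ℙ               ≡⟨ ⊕-identityʳ (parity d) ⟩
  parity d                    ∎)
  where
  d : ℕ
  d = y ∸ v
  open ≡-Reasoning

data Band (lo hi u : ℕ) : Set where
  below  : u < lo → Band lo hi u
  inside : lo ≤ u → u ≤ hi → Band lo hi u
  above  : hi < u → Band lo hi u

band : ∀ lo hi u → Band lo hi u
band lo hi u with u <? lo | hi <? u
... | yes u<lo | _        = below u<lo
... | no  u≮lo | yes hi<u = above hi<u
... | no  u≮lo | no  hi≮u = inside (≮⇒≥ u≮lo) (≮⇒≥ hi≮u)

module PathModel (a c : ℕ) (a≤c : a ≤ c) (Looped : ℕ → Set)
  (looped : ∀ {x} → a ≤ x → x ≤ c → Looped x)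
  (unlooped : ∀ {x} → x < a → ¬ Looped x) where

  data Adj : ℕ → ℕ → Set where
    step : ∀ {x y} → Step x y → Adj x y
    loop : ∀ {x} → Looped x → Adj x x

  adj-sym : ∀ {x y} → Adj x y → Adj y x
  adj-sym (step s) = step (step-sym s)
  adj-sym (loop l) = loop l

  adj-near : ∀ {x y} → Near x y → (x ≡ y → Looped x) → Adj x y
  adj-near {x} {y} (x≤ , y≤) equal⇒looped with <-cmp x y
  ... | tri< x<y _ _ rewrite ≤-antisym y≤ x<y = step up
  ... | tri≈ _ refl _ = loop (equal⇒looped refl)
  ... | tri> _ _ y<x rewrite ≤-antisym x≤ y<x = step down

  -- The invariant makes F u v = F u' v' on an edge force a loop: an unlooped value
  -- occurs only in a tail column v > c, where it is v itself, or in a prefix column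
  -- v < a, where its parity is that of v (rows below a) or of v + κ (rows above h);
  -- adjacent columns have opposite parities.
  module Criterion (F : ℕ → ℕ → ℕ) (h κ : ℕ) (a≤h : a ≤ h) where

    RowParity : ℕ → ℕ → ℕ → Set
    RowParity u v w = (u < a × parity w ≡ parity v) ⊎ (h < u × parity w ≡ parity (v + κ))

    Invariant : ℕ → ℕ → ℕ → Set
    Invariant u v w = Looped w ⊎ (v < a × RowParity u v w) ⊎ (c < v × w ≡ v)

    row-parity-clash : ∀ {u u' v v'} → u ≤ u' → u' ≤ suc u → Step v v' →
      RowParity u v (F u v) → RowParity u' v' (F u' v') → F u v ≢ F u' v'
    row-parity-clash _ _ s (inj₁ (_ , p)) (inj₁ (_ , p')) e =
      step-parity s (trans (sym p) (trans (cong parity e) p'))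
    row-parity-clash _ _ s (inj₂ (_ , p)) (inj₂ (_ , p')) e =
      step-parity (step-+ κ s) (trans (sym p) (trans (cong parity e) p'))
    row-parity-clash _ u'≤ _ (inj₁ (u<a , _)) (inj₂ (h<u' , _)) _ =
      <-irrefl refl (<-≤-trans h<u' (≤-trans u'≤ (≤-trans u<a a≤h)))
    row-parity-clash u≤ _ _ (inj₂ (h<u , _)) (inj₁ (u'<a , _)) _ =
      <-irrefl refl (<-≤-trans h<u (≤-trans u≤ (≤-trans (<⇒≤ u'<a) a≤h)))

    equal⇒looped : ∀ {u u' v v'} → u ≤ u' → u' ≤ suc u → Adj v v' →
      Invariant u v (F u v) → Invariant u' v' (F u' v') → F u v ≡ F u' v' → Looped (F u v)
    equal⇒looped _ _ _ (inj₁ l) _ _ = l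
    equal⇒looped _ _ _ _ (inj₁ l') e = subst Looped (sym e) l'
    equal⇒looped _ _ (loop lv) (inj₂ (inj₁ (v<a , _))) _ _ = ⊥-elim (unlooped v<a lv)
    equal⇒looped _ _ (loop lv) (inj₂ (inj₂ (_ , Fv))) _ _ = subst Looped (sym Fv) lv
    equal⇒looped u≤ u'≤ (step s) (inj₂ (inj₁ (_ , p))) (inj₂ (inj₁ (_ , p'))) e =
      ⊥-elim (row-parity-clash u≤ u'≤ s p p' e)
    equal⇒looped _ _ (step s) (inj₂ (inj₂ (_ , Fv))) (inj₂ (inj₂ (_ , Fv'))) e =
      ⊥-elim (step-parity s (cong parity (trans (sym Fv) (trans e Fv'))))
    equal⇒looped _ _ (step s) (inj₂ (inj₁ (v<a , _))) (inj₂ (inj₂ (c<v' , _))) _ =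
      ⊥-elim (<-irrefl refl (<-≤-trans c<v' (≤-trans (proj₂ (step-near s)) (≤-trans v<a a≤c))))
    equal⇒looped _ _ (step s) (inj₂ (inj₂ (c<v , _))) (inj₂ (inj₁ (v'<a , _))) _ =
      ⊥-elim (<-irrefl refl (<-≤-trans c<v (≤-trans (proj₁ (step-near s)) (≤-trans v'<a a≤c))))

    module _
      (near-step : ∀ u {v v'} → Step v v' → Near (F u v) (F (suc u) v'))
      (near-loop : ∀ u {v} → Looped v → Near (F u v) (F (suc u) v))
      (near-row  : ∀ u {v v'} → Step v v' → Near (F u v) (F u v'))
      (invariant : ∀ u v → Invariant u v (F u v))
      where

      near-next : ∀ u {v v'} → Adj v v' → Near (F u v) (F (suc u) v')
      near-next u (step s) = near-step u s
      near-next u (loop l) = near-loop u l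

      near-same : ∀ u {v v'} → Adj v v' → Near (F u v) (F u v')
      near-same u (step s) = near-row u s
      near-same u (loop _) = near-refl

      adj-next : ∀ u {v v'} → Adj v v' → Adj (F u v) (F (suc u) v')
      adj-next u {v} {v'} d = adj-near (near-next u d)
        (equal⇒looped (n≤1+n u) ≤-refl d (invariant u v) (invariant (suc u) v'))

      polymorphic : ∀ {u u' v v'} → Adj u u' → Adj v v' → Adj (F u v) (F u' v')
      polymorphic (step up) d = adj-next _ d
      polymorphic (step down) d = adj-sym (adj-next _ (adj-sym d))
      polymorphic {u} {_} {v} {v'} (loop _) d = adj-near (near-same u d)
        (equal⇒looped ≤-refl (n≤1+n u) d (invariant u v) (invariant u v'))

  last : ℕ
  last = c + a

  record PinnedPolymorphism (y : ℕ) : Set where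
    field
      F           : ℕ → ℕ → ℕ
      polymorphic : ∀ {u u' v v'} → Adj u u' → Adj v v' → Adj (F u v) (F u' v')
      idempotent  : ∀ x → F x x ≡ x
      first-row   : ∀ x → F 0 x ≡ x
      corner      : F last 0 ≡ y
      bounded     : ∀ u {v} → v ≤ last → F u v ≤ last

  module LargeTarget (y : ℕ) (a≤y : a ≤ y) (y≤last : y ≤ last) where

    ceiling : ℕ → ℕ
    ceiling v = a ⊔ (y ∸ v)

    a≤ceiling : ∀ v → a ≤ ceiling v
    a≤ceiling v = m≤m⊔n a (y ∸ v)

    ceiling≤c : ∀ {v} → a ≤ v → ceiling v ≤ c
    ceiling≤c {v} a≤v = ⊔-lub a≤c (begin
      y ∸ v     ≤⟨ ∸-monoʳ-≤ y a≤v ⟩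
      y ∸ a     ≤⟨ ∸-monoˡ-≤ a y≤last ⟩
      c + a ∸ a ≡⟨ m+n∸n≡m c a ⟩
      c         ∎)
      where open ≤-Reasoning

    near-ceiling : ∀ {v v'} → Step v v' → Near (ceiling v) (ceiling v')
    near-ceiling s = near-⊔ near-refl (near-∸ y (step-near s))

    -- Tail rows use the parity of v + y, which is also that of y ∸ v, so the parity
    -- bookkeeping holds whichever side of the minimum in combine is attained.
    row : ∀ {u} → Band a c u → ℕ → ℕ
    row {u} (below _)    v = zigzag (suc u) v
    row {u} (inside _ _) v = u
    row {u} (above _)    v = zigzag u (v + y)

    combine : ℕ → ℕ → ℕ
    combine w v = v ⊔ (w ⊓ ceiling v)

    F : ℕ → ℕ → ℕ
    F u v = combine (row (band a c u) v) v

    row-step : ∀ {u v v'} (b : Band a c u) (b' : Band a c (suc u)) →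
      Step v v' → Near (row b v) (row b' v')
    row-step {u} (below _) (below _) s = zigzag-step (suc u) s
    row-step {u} {v} (below _) (inside _ _) _ = near-zigzag (suc u) v
    row-step (below u<a) (above c<u+1) _ = ⊥-elim (<⇒≱ c<u+1 (≤-trans u<a a≤c))
    row-step (inside a≤u _) (below u+1<a) _ = ⊥-elim (<⇒≱ u+1<a (m≤n⇒m≤1+n a≤u))
    row-step (inside _ _) (inside _ _) _ = near-suc
    row-step {u} {_} {v'} (inside _ _) (above _) _ = near-zigzag-suc u (v' + y)
    row-step (above c<u) (below u+1<a) _ =
      ⊥-elim (<⇒≱ c<u (≤-trans (<⇒≤ (<-trans (n<1+n _) u+1<a)) a≤c))
    row-step (above c<u) (inside _ u+1≤c) _ = ⊥-elim (<⇒≱ c<u (<⇒≤ u+1≤c))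
    row-step {u} (above _) (above _) s = zigzag-step u (step-+ y s)

    row-near : ∀ {u} (b : Band a c u) v v' → Near (row b v) (row b v')
    row-near {u} (below _)    v v' = near-zigzag-row (suc u) v v'
    row-near     (inside _ _) _ _  = near-refl
    row-near {u} (above _)    v v' = near-zigzag-row u (v + y) (v' + y)

    row≤a : ∀ {u} v → u ≤ a → (b : Band a c u) → row b v ≤ a
    row≤a {u} v _   (below u<a)  = ≤-trans (zigzag-≤ (suc u) v) u<a
    row≤a     v u≤a (inside _ _) = u≤a
    row≤a     v u≤a (above c<u)  = ⊥-elim (<⇒≱ c<u (≤-trans u≤a a≤c))

    combine-absorb : ∀ {w v} → w ≤ v → combine w v ≡ v
    combine-absorb {w} {v} w≤v = m≥n⇒m⊔n≡m (≤-trans (m⊓n≤m w (ceiling v)) w≤v)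

    combine-ceiling : ∀ {w v} → ceiling v ≤ w → combine w v ≡ v ⊔ ceiling v
    combine-ceiling c≤w = cong (_ ⊔_) (m≥n⇒m⊓n≡n c≤w)

    loop-near : ∀ {u v} → a ≤ v → (b : Band a c u) (b' : Band a c (suc u)) →
      Near (combine (row b v) v) (combine (row b' v) v)
    loop-near {u} {v} a≤v (below u<a) b'
      rewrite combine-absorb (≤-trans (row≤a v (<⇒≤ u<a) (below u<a)) a≤v)
            | combine-absorb (≤-trans (row≤a v u<a b') a≤v) = near-refl
    loop-near a≤v (inside a≤u _) (below u+1<a) = ⊥-elim (<⇒≱ u+1<a (m≤n⇒m≤1+n a≤u))
    loop-near {u} {v} a≤v (inside _ _) (inside _ _) =
      near-⊔ (near-refl {v}) (near-⊓ (near-suc {u}) (near-refl {ceiling v}))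
    loop-near {u} {v} a≤v (inside _ _) (above _) =
      near-⊔ near-refl (near-⊓ (near-zigzag-suc u (v + y)) near-refl)
    loop-near a≤v (above c<u) (below u+1<a) =
      ⊥-elim (<⇒≱ c<u (≤-trans (<⇒≤ (<-trans (n<1+n _) u+1<a)) a≤c))
    loop-near a≤v (above c<u) (inside _ u+1≤c) = ⊥-elim (<⇒≱ c<u (<⇒≤ u+1≤c))
    loop-near {u} {v} a≤v (above c<u) (above c<u+1)
      = subst₂ Near (sym (combine-ceiling {v = v} (≤-trans (ceiling≤c a≤v) (<⇒≤-zigzag c<u))))
                    (sym (combine-ceiling {v = v} (≤-trans (ceiling≤c a≤v) (<⇒≤-zigzag c<u+1))))
                    near-refl

    open Criterion F c y a≤c

    tail-row : ∀ {u v} → v < a → c < u → Invariant u v (combine (zigzag u (v + y)) v)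
    tail-row {suc u} {v} v<a c<u = classify (c <? M)
      where
      M : ℕ
      M = zigzag (suc u) (v + y) ⊓ ceiling v

      a≤M : a ≤ M
      a≤M = ⊓-glb (≤-trans a≤c (<⇒≤-zigzag c<u)) (a≤ceiling v)

      parity-M : c < M → parity M ≡ parity (v + y)
      parity-M c<M with ⊓-sel (zigzag (suc u) (v + y)) (ceiling v) | ⊔-sel a (y ∸ v)
      ... | inj₁ M≡zigzag | _ = trans (cong parity M≡zigzag) (parity-zigzag u (v + y))
      ... | inj₂ M≡ceiling | inj₁ ceiling≡a =
        ⊥-elim (<⇒≱ c<M (≤-trans (≤-reflexive (trans M≡ceiling ceiling≡a)) a≤c))
      ... | inj₂ M≡ceiling | inj₂ ceiling≡y∸v =
        trans (cong parity M≡y∸v) (parity-∸ {v} {y} (<⇒≤ v<y))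
        where
        M≡y∸v : M ≡ y ∸ v
        M≡y∸v = trans M≡ceiling ceiling≡y∸v
        v<y : v < y
        v<y = m∸n≢0⇒n<m (λ y∸v≡0 → n≮0 (subst (c <_) (trans M≡y∸v y∸v≡0) c<M))

      classify : Dec (c < M) → Invariant (suc u) v (v ⊔ M)
      classify (no c≮M) =
        inj₁ (looped (≤-trans a≤M (m≤n⊔m v M)) (⊔-lub (≤-trans (<⇒≤ v<a) a≤c) (≮⇒≥ c≮M)))
      classify (yes c<M) =
        inj₂ (inj₁ (v<a , inj₂ (c<u , trans (cong parity v⊔M≡M) (parity-M c<M))))
        where
        v⊔M≡M : v ⊔ M ≡ M
        v⊔M≡M = m≤n⇒m⊔n≡n (≤-trans (<⇒≤ v<a) a≤M)

    invariant-at : ∀ {u v} → Band a c v → (b : Band a c u) → Invariant u v (combine (row b v) v)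
    invariant-at {v = v} (inside a≤v v≤c) _ =
      inj₁ (looped (≤-trans a≤v (m≤m⊔n v _)) (⊔-lub v≤c (≤-trans (m⊓n≤n _ _) (ceiling≤c a≤v))))
    invariant-at {v = v} (above c<v) _ =
      inj₂ (inj₂ (c<v , m≥n⇒m⊔n≡m (≤-trans (m⊓n≤n _ _) (≤-trans (ceiling≤c a≤v) (<⇒≤ c<v)))))
      where
      a≤v : a ≤ v
      a≤v = ≤-trans a≤c (<⇒≤ c<v)
    invariant-at {u} {v} (below v<a) (below u<a) = inj₂ (inj₁ (v<a , inj₁ (u<a , (begin
      parity (v ⊔ (zigzag (suc u) v ⊓ ceiling v)) ≡⟨ cong (λ w → parity (v ⊔ w)) zigzag⊓ceiling ⟩
      parity (v ⊔ zigzag (suc u) v)               ≡⟨ parity-⊔-zigzag (suc u) v ⟩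
      parity v                                    ∎))))
      where
      open ≡-Reasoning
      zigzag⊓ceiling : zigzag (suc u) v ⊓ ceiling v ≡ zigzag (suc u) v
      zigzag⊓ceiling = m≤n⇒m⊓n≡m (≤-trans (≤-trans (zigzag-≤ (suc u) v) u<a) (a≤ceiling v))
    invariant-at {u} {v} (below v<a) (inside a≤u u≤c) =
      inj₁ (looped (≤-trans (⊓-glb a≤u (a≤ceiling v)) (m≤n⊔m v _))
                   (⊔-lub (≤-trans (<⇒≤ v<a) a≤c) (≤-trans (m⊓n≤m u _) u≤c)))
    invariant-at (below v<a) (above c<u) = tail-row v<a c<u

    row≤self : ∀ {x} (b : Band a c x) → row b x ≤ x
    row≤self {x} (below _)    = ≤-reflexive (zigzag-suc-self x)
    row≤self     (inside _ _) = ≤-refl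
    row≤self {x} (above _)    = zigzag-≤ x (x + y)

    first-row≤ : ∀ v (b : Band a c 0) → row b v ≤ v
    first-row≤ v (below _)    = zigzag-≤-small 1 v ≤-refl
    first-row≤ v (inside _ _) = z≤n
    first-row≤ v (above ())

    y≤last-row : (b : Band a c last) → y ≤ row b 0
    y≤last-row (below last<a) = ⊥-elim (<⇒≱ last<a (m≤n+m a c))
    y≤last-row (inside _ _)   = y≤last
    y≤last-row (above _)      = ≤-zigzag-self y≤last

    F-step : ∀ u {v v'} → Step v v' → Near (F u v) (F (suc u) v')
    F-step u s =
      near-⊔ (step-near s) (near-⊓ (row-step (band a c u) (band a c (suc u)) s) (near-ceiling s))

    F-loop : ∀ u {v} → Looped v → Near (F u v) (F (suc u) v)
    F-loop u l = loop-near (≮⇒≥ (λ v<a → unlooped v<a l)) (band a c u) (band a c (suc u))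

    F-row : ∀ u {v v'} → Step v v' → Near (F u v) (F u v')
    F-row u {v} {v'} s =
      near-⊔ (step-near s) (near-⊓ (row-near (band a c u) v v') (near-ceiling s))

    pinned : PinnedPolymorphism y
    pinned = record
      { F           = F
      ; polymorphic = polymorphic F-step F-loop F-row
                        (λ u v → invariant-at (band a c v) (band a c u))
      ; idempotent  = λ x → combine-absorb (row≤self (band a c x))
      ; first-row   = λ x → combine-absorb (first-row≤ x (band a c 0))
      ; corner      = trans (cong (row (band a c last) 0 ⊓_) (m≤n⇒m⊔n≡n a≤y))
                            (m≥n⇒m⊓n≡n (y≤last-row (band a c last)))
      ; bounded     = λ _ {v} v≤last → ⊔-lub v≤last
          (≤-trans (m⊓n≤n _ (ceiling v)) (⊔-lub (m≤n+m a c) (≤-trans (m∸n≤m y v) y≤last)))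
      }

  module SmallTarget (y : ℕ) (y<a : y < a) where

    capped : ℕ → ℕ
    capped v = (v + y) ⊓ a

    near-capped : ∀ {v v'} → Step v v' → Near (capped v) (capped v')
    near-capped s = near-⊓ (near-+ y (step-near s)) near-refl

    -- Decreases by one per row from countdown (suc a) = a, and is at most 1 on the
    -- last row because last ≥ a + a.
    countdown : ℕ → ℕ
    countdown u = suc (a + a) ∸ u

    countdown≤a : ∀ {u} → a < u → countdown u ≤ a
    countdown≤a {u} a<u = ≤-trans (∸-monoʳ-≤ (suc (a + a)) a<u) (≤-reflexive (m+n∸m≡n a a))

    row : ∀ {u} → Band a a u → ℕ → ℕ
    row {u} (below _)    v = zigzag (suc u) v
    row     (inside _ _) v = a
    row {u} (above _)    v = capped v ⊔ zigzag (countdown u) (v + y)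

    F : ℕ → ℕ → ℕ
    F u v = v ⊔ row (band a a u) v

    row≤a : ∀ {u} (b : Band a a u) v → row b v ≤ a
    row≤a {u} (below u<a)  v = ≤-trans (zigzag-≤ (suc u) v) u<a
    row≤a     (inside _ _) v = ≤-refl
    row≤a {u} (above a<u)  v =
      ⊔-lub (m⊓n≤n (v + y) a) (≤-trans (zigzag-≤ (countdown u) (v + y)) (countdown≤a a<u))

    row-step : ∀ {u v v'} (b : Band a a u) (b' : Band a a (suc u)) →
      Step v v' → Near (row b v) (row b' v')
    row-step {u} (below _) (below _) s = zigzag-step (suc u) s
    row-step {u} {v} (below u<a) (inside a≤u+1 _) _ =
      subst (Near _) (≤-antisym u<a a≤u+1) (near-zigzag (suc u) v)
    row-step (below u<a) (above a<u+1) _ = ⊥-elim (<⇒≱ a<u+1 u<a)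
    row-step (inside a≤u _) (below u+1<a) _ = ⊥-elim (<⇒≱ u+1<a (m≤n⇒m≤1+n a≤u))
    row-step (inside a≤u _) (inside _ u+1≤a) _ = ⊥-elim (<⇒≱ u+1≤a a≤u)
    row-step {u} {_} {v'} (inside a≤u u≤a) (above _) _
      rewrite ≤-antisym u≤a a≤u | m+n∸m≡n a a =
      subst (λ z → Near z (capped v' ⊔ zigzag a (v' + y))) (m≤n⇒m⊔n≡n (m⊓n≤n (v' + y) a))
            (near-⊔ near-refl (near-sym (near-zigzag a (v' + y))))
    row-step (above a<u) (below u+1<a) _ = ⊥-elim (<⇒≱ a<u (<⇒≤ (<-trans (n<1+n _) u+1<a)))
    row-step (above a<u) (inside _ u+1≤a) _ = ⊥-elim (<⇒≱ a<u (<⇒≤ u+1≤a))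
    row-step {u} (above _) (above _) s
      rewrite sym (pred[m∸n]≡m∸[1+n] (suc (a + a)) u) =
      near-⊔ (near-capped s) (zigzag-pred-step (countdown u) (step-+ y s))

    row-near : ∀ {u v v'} (b : Band a a u) → Step v v' → Near (row b v) (row b v')
    row-near {u} {v} {v'} (below _) _ = near-zigzag-row (suc u) v v'
    row-near (inside _ _) _ = near-refl
    row-near {u} {v} {v'} (above _) s =
      near-⊔ (near-capped s) (near-zigzag-row (countdown u) (v + y) (v' + y))

    absorb : ∀ u {v} → a ≤ v → F u v ≡ v
    absorb u {v} a≤v = m≥n⇒m⊔n≡m (≤-trans (row≤a (band a a u) v) a≤v)

    F-step : ∀ u {v v'} → Step v v' → Near (F u v) (F (suc u) v')
    F-step u s = near-⊔ (step-near s) (row-step (band a a u) (band a a (suc u)) s)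

    F-loop : ∀ u {v} → Looped v → Near (F u v) (F (suc u) v)
    F-loop u {v} l = subst₂ Near (sym (absorb u a≤v)) (sym (absorb (suc u) a≤v)) near-refl
      where
      a≤v : a ≤ v
      a≤v = ≮⇒≥ (λ v<a → unlooped v<a l)

    F-row : ∀ u {v v'} → Step v v' → Near (F u v) (F u v')
    F-row u s = near-⊔ (step-near s) (row-near (band a a u) s)

    open Criterion F a y ≤-refl

    tail-row : ∀ {u v} → v < a → a < u →
      Invariant u v (v ⊔ (capped v ⊔ zigzag (countdown u) (v + y)))
    tail-row {u} {v} v<a a<u with a ≤? v + y
    ... | yes a≤v+y = inj₁ (looped a≤value (≤-trans (⊔-lub (<⇒≤ v<a) (row≤a (above a<u) v)) a≤c))
      where
      a≤value : a ≤ v ⊔ (capped v ⊔ zigzag (countdown u) (v + y))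
      a≤value = ≤-trans (≤-reflexive (sym (m≥n⇒m⊓n≡n a≤v+y))) (≤-trans (m≤m⊔n _ _) (m≤n⊔m v _))
    ... | no a≰v+y = inj₂ (inj₁ (v<a , inj₂ (a<u , (begin
      parity (v ⊔ (capped v ⊔ zigzag k (v + y))) ≡⟨ cong parity (m≤n⇒m⊔n≡n v≤value) ⟩
      parity (capped v ⊔ zigzag k (v + y))       ≡⟨ cong (λ w → parity (w ⊔ zigzag k (v + y))) capped≡ ⟩
      parity ((v + y) ⊔ zigzag k (v + y))        ≡⟨ parity-⊔-zigzag k (v + y) ⟩
      parity (v + y)                             ∎))))
      where
      open ≡-Reasoning
      k : ℕ
      k = countdown u
      capped≡ : capped v ≡ v + y
      capped≡ = m≤n⇒m⊓n≡m (<⇒≤ (≰⇒> a≰v+y))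
      v≤value : v ≤ capped v ⊔ zigzag k (v + y)
      v≤value = ≤-trans (≤-trans (m≤m+n v y) (≤-reflexive (sym capped≡))) (m≤m⊔n _ _)

    invariant-at : ∀ {u v} → Band a c v → (b : Band a a u) → Invariant u v (v ⊔ row b v)
    invariant-at {v = v} (inside a≤v v≤c) b =
      inj₁ (subst Looped (sym (m≥n⇒m⊔n≡m (≤-trans (row≤a b v) a≤v))) (looped a≤v v≤c))
    invariant-at {v = v} (above c<v) b =
      inj₂ (inj₂ (c<v , m≥n⇒m⊔n≡m (≤-trans (row≤a b v) (≤-trans a≤c (<⇒≤ c<v)))))
    invariant-at {u} {v} (below v<a) (below u<a) =
      inj₂ (inj₁ (v<a , inj₁ (u<a , parity-⊔-zigzag (suc u) v)))
    invariant-at {v = v} (below v<a) (inside _ _) =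
      inj₁ (looped (m≤n⊔m v a) (⊔-lub (≤-trans (<⇒≤ v<a) a≤c) a≤c))
    invariant-at (below v<a) (above a<u) = tail-row v<a a<u

    0<a : 0 < a
    0<a = ≤-<-trans z≤n y<a

    a<last : a < last
    a<last = <-≤-trans (m<m+n a 0<a) (+-monoˡ-≤ a a≤c)

    countdown-last≤1 : countdown last ≤ 1
    countdown-last≤1 =
      ≤-trans (∸-monoʳ-≤ (suc (a + a)) (+-monoˡ-≤ a a≤c)) (≤-reflexive (m+n∸n≡m 1 (a + a)))

    last-row : (b : Band a a last) → row b 0 ≡ y
    last-row (below last<a)   = ⊥-elim (<⇒≱ last<a (<⇒≤ a<last))
    last-row (inside _ last≤a) = ⊥-elim (<⇒≱ a<last last≤a)
    last-row (above _) = trans (cong (_⊔ zigzag (countdown last) y) (m≤n⇒m⊓n≡m (<⇒≤ y<a)))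
                               (m≥n⇒m⊔n≡m (zigzag-≤-small (countdown last) y countdown-last≤1))

    row≤self : ∀ {x} (b : Band a a x) → row b x ≤ x
    row≤self {x} (below _)    = ≤-reflexive (zigzag-suc-self x)
    row≤self     (inside a≤x _) = a≤x
    row≤self {x} (above a<x)  = ≤-trans (row≤a (above a<x) x) (<⇒≤ a<x)

    first-row≤ : ∀ v (b : Band a a 0) → row b v ≤ v
    first-row≤ v (below _)      = zigzag-≤-small 1 v ≤-refl
    first-row≤ v (inside a≤0 _) = ≤-trans a≤0 z≤n
    first-row≤ v (above ())

    pinned : PinnedPolymorphism y
    pinned = record
      { F           = F
      ; polymorphic = polymorphic F-step F-loop F-row
                        (λ u v → invariant-at (band a c v) (band a a u))
      ; idempotent  = λ x → m≥n⇒m⊔n≡m (row≤self (band a a x))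
      ; first-row   = λ x → m≥n⇒m⊔n≡m (first-row≤ x (band a a 0))
      ; corner      = last-row (band a a last)
      ; bounded     = λ u {v} v≤last → ⊔-lub v≤last (≤-trans (row≤a (band a a u) v) (<⇒≤ a<last))
      }

  pinned : ∀ y → y ≤ last → PinnedPolymorphism y
  pinned y y≤last with y <? a
  ... | yes y<a = SmallTarget.pinned y y<a
  ... | no  y≮a = LargeTarget.pinned y (≮⇒≥ y≮a) y≤last

module Word (a b' : ℕ) (α : Vec Bool a) where

  N : ℕ
  N = a + suc b' + a

  ones : Vec Bool (suc b')
  ones = replicate (suc b') true

  prefix : Vec Bool (a + suc b')
  prefix = replicate a false ++ ones

  β : Vec Bool N
  β = betaWord a (suc b') α

  HasLoop : ℕ → Set
  HasLoop x = ∃ λ (i : Fin N) → toℕ i ≡ x × lookup β i ≡ true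

  looped : ∀ {x} → a ≤ x → x ≤ a + b' → HasLoop x
  looped {x} a≤x x≤c = (a ↑ʳ j) ↑ˡ a , toℕ-i , lookup-i
    where
    j<1+b' : x ∸ a < suc b'
    j<1+b' = s≤s (m≤n+o⇒m∸n≤o x a x≤c)
    j : Fin (suc b')
    j = fromℕ< j<1+b'
    toℕ-i : toℕ ((a ↑ʳ j) ↑ˡ a) ≡ x
    toℕ-i = begin
      toℕ ((a ↑ʳ j) ↑ˡ a) ≡⟨ toℕ-↑ˡ (a ↑ʳ j) a ⟩
      toℕ (a ↑ʳ j)        ≡⟨ toℕ-↑ʳ a j ⟩
      a + toℕ j           ≡⟨ cong (a +_) (toℕ-fromℕ< j<1+b') ⟩
      a + (x ∸ a)         ≡⟨ m+[n∸m]≡n a≤x ⟩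
      x                   ∎
      where open ≡-Reasoning
    lookup-i : lookup β ((a ↑ʳ j) ↑ˡ a) ≡ true
    lookup-i = begin
      lookup β ((a ↑ʳ j) ↑ˡ a) ≡⟨ lookup-++ˡ prefix α (a ↑ʳ j) ⟩
      lookup prefix (a ↑ʳ j)   ≡⟨ lookup-++ʳ (replicate a false) ones j ⟩
      lookup ones j            ≡⟨ lookup-replicate j true ⟩
      true                     ∎
      where open ≡-Reasoning

  unlooped : ∀ {x} → x < a → ¬ HasLoop x
  unlooped x<a (i , refl , loop-i) = false≢true (trans (sym lookup-i) loop-i)
    where
    false≢true : false ≢ true
    false≢true ()
    i<prefix : toℕ i < a + suc b'
    i<prefix = <-≤-trans x<a (m≤m+n a (suc b'))
    k′ : Fin (a + suc b')
    k′ = fromℕ< i<prefix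
    k′<a : toℕ k′ < a
    k′<a = subst (_< a) (sym (toℕ-fromℕ< i<prefix)) x<a
    lookup-i : lookup β i ≡ false
    lookup-i = begin
      lookup β i                               ≡⟨ lookup-++-< prefix α i i<prefix ⟩
      lookup prefix k′                         ≡⟨ lookup-++-< (replicate a false) ones k′ k′<a ⟩
      lookup (replicate a false) (fromℕ< k′<a) ≡⟨ lookup-replicate (fromℕ< k′<a) false ⟩
      false                                    ∎
      where open ≡-Reasoning

  open PathModel a (a + b') (m≤m+n a b') HasLoop looped unlooped

  edge⇒adj : ∀ {u v} → Edge β u v → Adj (toℕ u) (toℕ v)
  edge⇒adj {u} (inj₁ e) = subst (Adj (toℕ u)) (sym e) (step up)
  edge⇒adj {_} {v} (inj₂ (inj₁ e)) = subst (λ x → Adj x (toℕ v)) (sym e) (step down)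
  edge⇒adj {u} (inj₂ (inj₂ (refl , loop-u))) = loop (u , refl , loop-u)

  adj⇒edge : ∀ {x y} {u v : Fin N} → Adj x y → toℕ u ≡ x → toℕ v ≡ y → Edge β u v
  adj⇒edge (step up)   eu ev = inj₁ (trans ev (cong suc (sym eu)))
  adj⇒edge (step down) eu ev = inj₂ (inj₁ (trans eu (cong suc (sym ev))))
  adj⇒edge {u = u} {v} (loop (i , ei , loop-i)) eu ev
    with refl ← toℕ-injective {i = u} {v} (trans eu (sym ev))
    with refl ← toℕ-injective {i = i} {u} (trans ei (sym eu))
    = inj₂ (inj₂ (refl , loop-i))

  N≡1+last : N ≡ suc last
  N≡1+last = cong (_+ a) (+-suc a b')

  toℕ≤last : (i : Fin N) → toℕ i ≤ last
  toℕ≤last i = ≤-pred (subst (toℕ i <_) N≡1+last (toℕ<n i))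

  toℕ-first : toℕ (firstIndex a b') ≡ 0
  toℕ-first = toℕ-fromℕ< _

  toℕ-last : toℕ (lastIndex a b') ≡ last
  toℕ-last = trans (toℕ-fromℕ< _) (cong (_∸ 1) N≡1+last)

  realise : (y : Fin N) → PinnedPolymorphism (toℕ y) →
    Σ (Fin N → Fin N → Fin N) λ f →
      IsPolymorphism β f × IsIdempotent f
      × (∀ x → f (firstIndex a b') x ≡ x) × f (lastIndex a b') (firstIndex a b') ≡ y
  realise y P = f , f-polymorphic , f-idempotent , f-first , f-corner
    where
    open PinnedPolymorphism P
    F<N : ∀ u v → F (toℕ u) (toℕ v) < N
    F<N u v = subst (F (toℕ u) (toℕ v) <_) (sym N≡1+last) (s≤s (bounded (toℕ u) (toℕ≤last v)))
    f : Fin N → Fin N → Fin N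
    f u v = fromℕ< (F<N u v)
    toℕ-f : ∀ u v → toℕ (f u v) ≡ F (toℕ u) (toℕ v)
    toℕ-f u v = toℕ-fromℕ< (F<N u v)
    f-polymorphic : IsPolymorphism β f
    f-polymorphic u u' v v' e e' =
      adj⇒edge (polymorphic (edge⇒adj e) (edge⇒adj e')) (toℕ-f u v) (toℕ-f u' v')
    f-idempotent : IsIdempotent f
    f-idempotent x = toℕ-injective (trans (toℕ-f x x) (idempotent (toℕ x)))
    f-first : ∀ x → f (firstIndex a b') x ≡ x
    f-first x = toℕ-injective
      (trans (toℕ-f _ x) (trans (cong (λ w → F w (toℕ x)) toℕ-first) (first-row (toℕ x))))
    f-corner : f (lastIndex a b') (firstIndex a b') ≡ y
    f-corner = toℕ-injective (trans (toℕ-f _ _) (trans (cong₂ F toℕ-last toℕ-first) corner))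

  pinned-at : (y : Fin N) → PinnedPolymorphism (toℕ y)
  pinned-at y = pinned (toℕ y) (toℕ≤last y)

lemma2 : (a b' : ℕ) (α : Vec Bool a) (y : Fin (a + suc b' + a)) →
    Σ (Fin (a + suc b' + a) → Fin (a + suc b' + a) → Fin (a + suc b' + a)) λ f →
      IsPolymorphism (betaWord a (suc b') α) f
      × IsIdempotent f
      × (∀ x → f (firstIndex a b') x ≡ x)
      × f (lastIndex a b') (firstIndex a b') ≡ y
lemma2 a b' α y = realise y (pinned-at y)
  where open Word a b' α
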